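{- Let $(\mathcal{G}_n)_{n\ge1}$ be the pseudofractal scale-free web with hub vertices as defined below, and for $k\in\{0,1\}$ let $\alpha_n^k$ denote the largest cardinality of an independent set of $\mathcal{G}_n$ containing exactly $k$ hub vertices. Then for every $n\geq 1$, $$\alpha_{n+1}^0=\max\{3\alpha_n^0,\;2\alpha_n^0+\alpha_n^1,\;\alpha_n^0+2\alpha_n^1,\;3\alpha_n^1\},$$ $$\alpha_{n+1}^1=\max\{2\alpha_n^1+\alpha_n^0-1,\;3\alpha_n^1-1\}.$$
   Context: The pseudofractal scale-free web is the sequence of simple graphs $\mathcal{G}_n$, $n\ge 1$, defined by: $\mathcal{G}_1$ is a triangle; for $n>1$, $\mathcal{G}_n$ is obtained from $\mathcal{G}_{n-1}$ by adding, for every edge $(u,v)$ of $\mathcal{G}_{n-1}$, a new vertex adjacent to exactly $u$ and $v$. The hub vertices of $\mathcal{G}_n$ are the three vertices of the initial triangle $\mathcal{G}_1$ (they are pairwise adjacent in every $\mathcal{G}_n$, so an independent set contains at most one of them). An independent set is a set of pairwise non-adjacent vertices. -}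

module Defs where

open import Data.Nat using (ℕ; zero; suc; _+_; _<ᵇ_; _≤_)
open import Data.Fin using (Fin; toℕ; _↑ˡ_; _↑ʳ_) renaming (zero to fzero; suc to fsuc)
open import Data.Fin.Subset using (Subset; inside; outside; _∈_; _∩_; ∣_∣)
open import Data.List using (List; []; _∷_; _++_; map; length; lookup; tabulate; concat)
open import Data.List.Relation.Unary.All using (All)
open import Data.Product using (_×_; _,_; Σ; proj₁; proj₂)
open import Data.Bool using (if_then_else_)
open import Data.Vec as Vec using ()
open import Relation.Nullary using (¬_)
open import Relation.Binary.PropositionalEquality using (_≡_)

record Graph : Set where
  constructor graph
  field
    V : ℕ
    E : List (Fin V × Fin V)
open Graph public

triangle : Graph
triangle = graph 3 ((fzero , fsuc fzero)
                   ∷ (fsuc fzero , fsuc (fsuc fzero))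
                   ∷ (fzero , fsuc (fsuc fzero)) ∷ [])

-- One growth step: old vertices keep their labels 0..V-1; the new vertex
-- for the i-th edge (u,v) is V + i, adjacent to exactly u and v.
step : Graph → Graph
step (graph V E) = graph (V + length E) (map old E ++ concat (tabulate new))
  where
    old : Fin V × Fin V → Fin (V + length E) × Fin (V + length E)
    old (u , v) = (u ↑ˡ length E) , (v ↑ˡ length E)
    new : Fin (length E) → List (Fin (V + length E) × Fin (V + length E))
    new i with lookup E i
    ... | (u , v) = ((u ↑ˡ length E) , (V ↑ʳ i))
                  ∷ ((v ↑ˡ length E) , (V ↑ʳ i)) ∷ []

-- Pseudofractal scale-free web 𝒢 n for n ≥ 1 (𝒢 0 is an unused dummy).
𝒢 : ℕ → Graph
𝒢 zero = triangle
𝒢 (suc zero) = triangle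
𝒢 (suc (suc n)) = step (𝒢 (suc n))

Independent : (G : Graph) → Subset (V G) → Set
Independent G S = All (λ e → ¬ (proj₁ e ∈ S × proj₂ e ∈ S)) (E G)

-- The hub vertices: the labels 0,1,2 (the vertices of the initial triangle).
hubs : (G : Graph) → Subset (V G)
hubs G = Vec.tabulate (λ x → if toℕ x <ᵇ 3 then inside else outside)

hubCount : (G : Graph) → Subset (V G) → ℕ
hubCount G S = ∣ S ∩ hubs G ∣

IsMaxIndep : (G : Graph) → ℕ → ℕ → Set
IsMaxIndep G k m =
  Σ (Subset (V G)) (λ S → Independent G S × hubCount G S ≡ k × ∣ S ∣ ≡ m)
  × ((S : Subset (V G)) → Independent G S → hubCount G S ≡ k → ∣ S ∣ ≤ m)

module Submission where

-- Growing a graph k times turns every edge (u , v) into a copy of the same gadget. An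
-- independent set of the grown graph thus restricts to one of the original graph plus, on
-- each edge, at most inner k a b interior vertices (a, b say whether u and v are taken),
-- and this bound is attained. Both facts go by induction on k, peeling off the first growth
-- step, where every edge gets exactly one new vertex. As 𝒢 (n + 1) is the triangle grown
-- n times, α⁰ and α¹ are read off the triangle with no or one hub taken, and the
-- recursion defining inner becomes the stated recurrence.

open import Defs
open import Data.Bool using (Bool; true; false; _∧_; if_then_else_)
open import Data.Empty using (⊥-elim)
open import Data.Fin using (Fin; toℕ; _↑ˡ_; _↑ʳ_) renaming (zero to fzero; suc to fsuc)
open import Data.Fin.Patterns using (0F; 1F; 2F)
open import Data.Fin.Properties using (toℕ-↑ˡ; toℕ-injective)
open import Data.Fin.Subset using (Subset; inside; outside; _∈_; _∩_; ∣_∣)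
open import Data.List using (List; []; _∷_; _++_; map; length; lookup; tabulate; concat)
open import Data.List.Properties using (map-++; map-∘; tabulate-lookup)
open import Data.List.Relation.Unary.All as All using (All; []; _∷_)
open import Data.List.Relation.Unary.All.Properties using (++⁺; ++⁻; map⁺; map⁻; concat⁺; concat⁻; tabulate⁺; tabulate⁻)
open import Data.Nat using (ℕ; zero; suc; _+_; _*_; _∸_; _≤_; _⊔_; _<ᵇ_; z≤n; s≤s)
open import Data.Nat.ListAction using (sum)
open import Data.Nat.ListAction.Properties using (sum-++)
open import Data.Nat.Properties
open import Algebra.Properties.CommutativeMonoid.Sum +-0-commutativeMonoid
  using (sum-cong-≗; ∑-distrib-+) renaming (sum to ∑)
open import Data.Nat.Tactic.RingSolver using (solve-∀)
open import Data.Product using (_×_; _,_; Σ; proj₁; proj₂)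
open import Data.Sum using (inj₁; inj₂)
open import Data.Vec as Vec using ()
open import Data.Vec.Functional as Vector using ()
open import Data.Vec.Functional.Properties using (lookup-++ˡ; lookup-++ʳ)
open import Data.Vec.Properties using (lookup⇒[]=; []=⇒lookup; lookup∘tabulate)
open import Function using (_∘_; id)
open import Relation.Nullary using (¬_)
open import Relation.Binary.PropositionalEquality

∑-mono-≤ : ∀ {n} {f g : Fin n → ℕ} → (∀ i → f i ≤ g i) → ∑ f ≤ ∑ g
∑-mono-≤ {zero}  f≤g = z≤n
∑-mono-≤ {suc n} f≤g = +-mono-≤ (f≤g fzero) (∑-mono-≤ (f≤g ∘ fsuc))

∑-splitAt : ∀ m {n} (f : Fin (m + n) → ℕ) → ∑ f ≡ ∑ (f ∘ (_↑ˡ n)) + ∑ (f ∘ (m ↑ʳ_))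
∑-splitAt zero    f = refl
∑-splitAt (suc m) f = trans (cong (f fzero +_) (∑-splitAt m (f ∘ fsuc))) (sym (+-assoc (f fzero) _ _))

sum-map≡∑-lookup : ∀ {A : Set} (c : A → ℕ) (xs : List A) → sum (map c xs) ≡ ∑ (c ∘ lookup xs)
sum-map≡∑-lookup c []       = refl
sum-map≡∑-lookup c (x ∷ xs) = cong (c x +_) (sum-map≡∑-lookup c xs)

sum-map-concat-tabulate : ∀ {A : Set} (c : A → ℕ) {n} (f : Fin n → List A) →
                          sum (map c (concat (tabulate f))) ≡ ∑ (λ i → sum (map c (f i)))
sum-map-concat-tabulate c {zero}  f = refl
sum-map-concat-tabulate c {suc n} f = begin
  sum (map c (f fzero ++ concat (tabulate (f ∘ fsuc))))
    ≡⟨ cong sum (map-++ c (f fzero) _) ⟩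
  sum (map c (f fzero) ++ map c (concat (tabulate (f ∘ fsuc))))
    ≡⟨ sum-++ (map c (f fzero)) _ ⟩
  sum (map c (f fzero)) + sum (map c (concat (tabulate (f ∘ fsuc))))
    ≡⟨ cong (sum (map c (f fzero)) +_) (sum-map-concat-tabulate c (f ∘ fsuc)) ⟩
  ∑ (λ i → sum (map c (f i)))
    ∎
  where open ≡-Reasoning

All-lookup : ∀ {A : Set} {P : A → Set} {xs : List A} → All P xs → ∀ i → P (lookup xs i)
All-lookup {P = P} {xs} pxs = tabulate⁻ (subst (All P) (sym (tabulate-lookup xs)) pxs)

𝟙 : Bool → ℕ
𝟙 true  = 1
𝟙 false = 0

count : ∀ {n} → (Fin n → Bool) → ℕ
count s = ∑ (𝟙 ∘ s)

count-cong : ∀ {n} {s s′ : Fin n → Bool} → (∀ x → s x ≡ s′ x) → count s ≡ count s′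
count-cong s≗s′ = sum-cong-≗ (cong 𝟙 ∘ s≗s′)

∣S∣≡count : ∀ {n} (S : Subset n) → ∣ S ∣ ≡ count (Vec.lookup S)
∣S∣≡count Vec.[]           = refl
∣S∣≡count (true Vec.∷ S)  = cong suc (∣S∣≡count S)
∣S∣≡count (false Vec.∷ S) = ∣S∣≡count S

Independentᵇ : ∀ {n} → List (Fin n × Fin n) → (Fin n → Bool) → Set
Independentᵇ E s = All (λ e → s (proj₁ e) ∧ s (proj₂ e) ≡ false) E

Independentᵇ-cong : ∀ {n} (E : List (Fin n × Fin n)) {s s′ : Fin n → Bool} →
                    (∀ x → s x ≡ s′ x) → Independentᵇ E s → Independentᵇ E s′
Independentᵇ-cong E s≗s′ =
  All.map (λ {e} → subst₂ (λ a b → a ∧ b ≡ false) (s≗s′ (proj₁ e)) (s≗s′ (proj₂ e)))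

module _ {n} (S : Subset n) (u v : Fin n) where

  ¬both⇒∧≡false : ¬ (u ∈ S × v ∈ S) → Vec.lookup S u ∧ Vec.lookup S v ≡ false
  ¬both⇒∧≡false ¬both with Vec.lookup S u in su | Vec.lookup S v in sv
  ... | true  | true  = ⊥-elim (¬both (lookup⇒[]= u S su , lookup⇒[]= v S sv))
  ... | true  | false = refl
  ... | false | _     = refl

  ∧≡false⇒¬both : Vec.lookup S u ∧ Vec.lookup S v ≡ false → ¬ (u ∈ S × v ∈ S)
  ∧≡false⇒¬both su∧sv≡false (u∈S , v∈S)
    with () ← subst₂ (λ a b → a ∧ b ≡ false) ([]=⇒lookup u∈S) ([]=⇒lookup v∈S) su∧sv≡false

Independent⇒Independentᵇ : ∀ G S → Independent G S → Independentᵇ (E G) (Vec.lookup S)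
Independent⇒Independentᵇ G S = All.map (λ {e} → ¬both⇒∧≡false S (proj₁ e) (proj₂ e))

Independentᵇ⇒Independent : ∀ G S → Independentᵇ (E G) (Vec.lookup S) → Independent G S
Independentᵇ⇒Independent G S = All.map (λ {e} → ∧≡false⇒¬both S (proj₁ e) (proj₂ e))

-- inner k a b is the largest number of vertices, other than u and v, that an independent
-- set can take among the vertices grown from an edge (u , v) in k steps, given whether
-- u and v are in the set (a, b).  One step subdivides (u , v) into a new vertex w and the
-- three edges (u , v), (u , w), (v , w); w can only be taken when neither u nor v is.
inner₀ inner₁ : ℕ → ℕ
inner₀ zero    = 0
inner₀ (suc k) = (3 * inner₀ k) ⊔ suc (inner₀ k + 2 * inner₁ k)
inner₁ zero    = 0
inner₁ (suc k) = 2 * inner₁ k + inner₀ k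

inner : ℕ → Bool → Bool → ℕ
inner k false false = inner₀ k
inner k false true  = inner₁ k
inner k true  false = inner₁ k
inner k true  true  = 0

inner-zero : ∀ a b → inner 0 a b ≡ 0
inner-zero false false = refl
inner-zero false true  = refl
inner-zero true  false = refl
inner-zero true  true  = refl

subdivided : ℕ → Bool → Bool → Bool → ℕ
subdivided k a b w = 𝟙 w + inner k a b + (inner k a w + inner k b w)

subdivided-none : ∀ k → subdivided k false false false ≡ 3 * inner₀ k
subdivided-none k = arith (inner₀ k)
  where arith : ∀ x → x + (x + x) ≡ 3 * x
        arith = solve-∀

subdivided-onlyNew : ∀ k → subdivided k false false true ≡ suc (inner₀ k + 2 * inner₁ k)
subdivided-onlyNew k = cong suc (arith (inner₀ k) (inner₁ k))
  where arith : ∀ x y → x + (y + y) ≡ x + 2 * y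
        arith = solve-∀

subdivided-onlyLeft : ∀ k → subdivided k true false false ≡ inner₁ (suc k)
subdivided-onlyLeft k = arith (inner₀ k) (inner₁ k)
  where arith : ∀ x y → y + (y + x) ≡ 2 * y + x
        arith = solve-∀

subdivided-onlyRight : ∀ k → subdivided k false true false ≡ inner₁ (suc k)
subdivided-onlyRight k = arith (inner₀ k) (inner₁ k)
  where arith : ∀ x y → y + (x + y) ≡ 2 * y + x
        arith = solve-∀

subdivided-≤ : ∀ k a b w → a ∧ b ≡ false → a ∧ w ≡ false → b ∧ w ≡ false →
               subdivided k a b w ≤ inner (suc k) a b
subdivided-≤ k false false false _ _ _ = ≤-trans (≤-reflexive (subdivided-none k)) (m≤m⊔n _ _)
subdivided-≤ k false false true  _ _ _ = ≤-trans (≤-reflexive (subdivided-onlyNew k)) (m≤n⊔m _ _)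
subdivided-≤ k true  false false _ _ _ = ≤-reflexive (subdivided-onlyLeft k)
subdivided-≤ k false true  false _ _ _ = ≤-reflexive (subdivided-onlyRight k)

subdivided-attained : ∀ k a b → a ∧ b ≡ false →
  Σ Bool λ w → (a ∧ w ≡ false) × (b ∧ w ≡ false) × subdivided k a b w ≡ inner (suc k) a b
subdivided-attained k false false _ with ≤-total (3 * inner₀ k) (suc (inner₀ k + 2 * inner₁ k))
... | inj₁ ≤ = true  , refl , refl , trans (subdivided-onlyNew k) (sym (m≤n⇒m⊔n≡n ≤))
... | inj₂ ≥ = false , refl , refl , trans (subdivided-none k) (sym (m≥n⇒m⊔n≡m ≥))
subdivided-attained k true  false _ = false , refl , refl , subdivided-onlyLeft k
subdivided-attained k false true  _ = false , refl , refl , subdivided-onlyRight k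

weight : ∀ {n} → ℕ → (Fin n → Bool) → List (Fin n × Fin n) → ℕ
weight k s E = sum (map (λ e → inner k (s (proj₁ e)) (s (proj₂ e))) E)

weight-zero : ∀ {n} (s : Fin n → Bool) E → weight 0 s E ≡ 0
weight-zero s []      = refl
weight-zero s (e ∷ E) = cong₂ _+_ (inner-zero (s (proj₁ e)) (s (proj₂ e))) (weight-zero s E)

weight-++ : ∀ {n} k (s : Fin n → Bool) xs ys → weight k s (xs ++ ys) ≡ weight k s xs + weight k s ys
weight-++ k s xs ys = trans (cong sum (map-++ _ xs ys)) (sum-++ (map _ xs) _)

module Step (G : Graph) where

  m : ℕ
  m = length (E G)

  old : Fin (V G) → Fin (V (step G))
  old x = x ↑ˡ m

  new : Fin m → Fin (V (step G))
  new i = V G ↑ʳ i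

  u v : Fin m → Fin (V G)
  u i = proj₁ (lookup (E G) i)
  v i = proj₂ (lookup (E G) i)

  oldEdge : Fin (V G) × Fin (V G) → Fin (V (step G)) × Fin (V (step G))
  oldEdge (x , y) = old x , old y

  newEdges : Fin m → List (Fin (V (step G)) × Fin (V (step G)))
  newEdges i = (old (u i) , new i) ∷ (old (v i) , new i) ∷ []

  NewEdgesIndependent : (Fin (V (step G)) → Bool) → Set
  NewEdgesIndependent t = ∀ i → (t (old (u i)) ∧ t (new i) ≡ false) × (t (old (v i)) ∧ t (new i) ≡ false)

  Independentᵇ-step⁻ : ∀ t → Independentᵇ (E (step G)) t →
                       Independentᵇ (E G) (t ∘ old) × NewEdgesIndependent t
  Independentᵇ-step⁻ t ind with ++⁻ (map oldEdge (E G)) ind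
  ... | indOld , indNew = map⁻ indOld , λ i → pair (tabulate⁻ (concat⁻ indNew) i)
    where
    pair : ∀ {i} → Independentᵇ (newEdges i) t →
           (t (old (u i)) ∧ t (new i) ≡ false) × (t (old (v i)) ∧ t (new i) ≡ false)
    pair (p ∷ q ∷ []) = p , q

  Independentᵇ-step⁺ : ∀ t → Independentᵇ (E G) (t ∘ old) → NewEdgesIndependent t →
                       Independentᵇ (E (step G)) t
  Independentᵇ-step⁺ t indOld indNew =
    ++⁺ (map⁺ indOld) (concat⁺ (tabulate⁺ (λ i → proj₁ (indNew i) ∷ proj₂ (indNew i) ∷ [])))

  count+weight-step : ∀ k t → count t + weight k t (E (step G)) ≡
    count (t ∘ old) + ∑ (λ i → subdivided k (t (old (u i))) (t (old (v i))) (t (new i)))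
  count+weight-step k t = begin
    count t + weight k t (E (step G))
      ≡⟨ cong₂ _+_ (∑-splitAt (V G) (𝟙 ∘ t))
                   (trans (weight-++ k t (map oldEdge (E G)) _) (cong₂ _+_ weight-old weight-new)) ⟩
    (count (t ∘ old) + ∑ (𝟙 ∘ w)) + (∑ innerOld + ∑ innerNew)
      ≡⟨ regroup (count (t ∘ old)) (∑ (𝟙 ∘ w)) (∑ innerOld) (∑ innerNew) ⟩
    count (t ∘ old) + ((∑ (𝟙 ∘ w) + ∑ innerOld) + ∑ innerNew)
      ≡⟨ cong (count (t ∘ old) +_) (trans (∑-distrib-+ _ innerNew) (cong (_+ ∑ innerNew) (∑-distrib-+ (𝟙 ∘ w) innerOld))) ⟨
    count (t ∘ old) + ∑ (λ i → subdivided k (a i) (b i) (w i))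
      ∎
    where
    open ≡-Reasoning
    a b w : Fin m → Bool
    a = t ∘ old ∘ u
    b = t ∘ old ∘ v
    w = t ∘ new
    innerOld innerNew : Fin m → ℕ
    innerOld i = inner k (a i) (b i)
    innerNew i = inner k (a i) (w i) + inner k (b i) (w i)
    weight-old : weight k t (map oldEdge (E G)) ≡ ∑ innerOld
    weight-old = trans (cong sum (sym (map-∘ (E G)))) (sum-map≡∑-lookup _ (E G))
    weight-new : weight k t (concat (tabulate newEdges)) ≡ ∑ innerNew
    weight-new = trans (sum-map-concat-tabulate _ newEdges)
                       (sum-cong-≗ (λ i → cong (inner k (a i) (w i) +_) (+-identityʳ _)))
    regroup : ∀ x y z z′ → (x + y) + (z + z′) ≡ x + ((y + z) + z′)
    regroup = solve-∀

  count+weight-step-≤ : ∀ k t → Independentᵇ (E (step G)) t →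
    count t + weight k t (E (step G)) ≤ count (t ∘ old) + weight (suc k) (t ∘ old) (E G)
  count+weight-step-≤ k t ind = begin
    count t + weight k t (E (step G))
      ≡⟨ count+weight-step k t ⟩
    count (t ∘ old) + ∑ (λ i → subdivided k (t (old (u i))) (t (old (v i))) (t (new i)))
      ≤⟨ +-monoʳ-≤ (count (t ∘ old)) (∑-mono-≤ λ i →
           subdivided-≤ k (t (old (u i))) (t (old (v i))) (t (new i)) (All-lookup indOld i) (proj₁ (indNew i)) (proj₂ (indNew i))) ⟩
    count (t ∘ old) + ∑ (λ i → inner (suc k) (t (old (u i))) (t (old (v i))))
      ≡⟨ cong (count (t ∘ old) +_) (sum-map≡∑-lookup _ (E G)) ⟨
    count (t ∘ old) + weight (suc k) (t ∘ old) (E G)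
      ∎
    where
    open ≤-Reasoning
    indOld = proj₁ (Independentᵇ-step⁻ t ind)
    indNew = proj₂ (Independentᵇ-step⁻ t ind)

  extend-step : ∀ k T → Independentᵇ (E G) T →
    Σ (Fin (V (step G)) → Bool) λ t → Independentᵇ (E (step G)) t × (∀ x → t (old x) ≡ T x)
      × count t + weight k t (E (step G)) ≡ count T + weight (suc k) T (E G)
  extend-step k T ind =
    t , Independentᵇ-step⁺ t (Independentᵇ-cong (E G) (sym ∘ t-old) ind) t-newEdges , t-old , size
    where
    choice : ∀ i → Σ Bool λ w → (T (u i) ∧ w ≡ false) × (T (v i) ∧ w ≡ false)
                                × subdivided k (T (u i)) (T (v i)) w ≡ inner (suc k) (T (u i)) (T (v i))
    choice i = subdivided-attained k (T (u i)) (T (v i)) (All-lookup ind i)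
    t : Fin (V (step G)) → Bool
    t = T Vector.++ (proj₁ ∘ choice)
    t-old : ∀ x → t (old x) ≡ T x
    t-old = lookup-++ˡ T _
    t-new : ∀ i → t (new i) ≡ proj₁ (choice i)
    t-new = lookup-++ʳ T _
    t-newEdges : NewEdgesIndependent t
    t-newEdges i rewrite t-old (u i) | t-old (v i) | t-new i =
      proj₁ (proj₂ (choice i)) , proj₁ (proj₂ (proj₂ (choice i)))
    t-subdivided : ∀ i → subdivided k (t (old (u i))) (t (old (v i))) (t (new i)) ≡ inner (suc k) (T (u i)) (T (v i))
    t-subdivided i rewrite t-old (u i) | t-old (v i) | t-new i = proj₂ (proj₂ (proj₂ (choice i)))
    size : count t + weight k t (E (step G)) ≡ count T + weight (suc k) T (E G)
    size = trans (count+weight-step k t)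
                 (cong₂ _+_ (count-cong t-old) (trans (sum-cong-≗ t-subdivided) (sym (sum-map≡∑-lookup _ (E G)))))

grow : ℕ → Graph → Graph
grow zero    G = G
grow (suc k) G = grow k (step G)

embed : ∀ k G → Fin (V G) → Fin (V (grow k G))
embed zero    G = id
embed (suc k) G = embed k (step G) ∘ Step.old G

toℕ-embed : ∀ k G x → toℕ (embed k G x) ≡ toℕ x
toℕ-embed zero    G x = refl
toℕ-embed (suc k) G x = trans (toℕ-embed k (step G) (Step.old G x)) (toℕ-↑ˡ x (length (E G)))

step-grow : ∀ k G → step (grow k G) ≡ grow k (step G)
step-grow zero    G = refl
step-grow (suc k) G = step-grow k (step G)

𝒢≡grow : ∀ k → 𝒢 (suc k) ≡ grow k triangle
𝒢≡grow zero    = refl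
𝒢≡grow (suc k) = trans (cong step (𝒢≡grow k)) (step-grow k triangle)

Independentᵇ-embed : ∀ k G s → Independentᵇ (E (grow k G)) s → Independentᵇ (E G) (s ∘ embed k G)
Independentᵇ-embed zero    G s ind = ind
Independentᵇ-embed (suc k) G s ind =
  proj₁ (Step.Independentᵇ-step⁻ G (s ∘ embed k (step G)) (Independentᵇ-embed k (step G) s ind))

count-grow-≤ : ∀ k G s → Independentᵇ (E (grow k G)) s →
          count s ≤ count (s ∘ embed k G) + weight k (s ∘ embed k G) (E G)
count-grow-≤ zero    G s ind = m≤m+n (count s) _
count-grow-≤ (suc k) G s ind =
  ≤-trans (count-grow-≤ k (step G) s ind)
          (Step.count+weight-step-≤ G k (s ∘ embed k (step G)) (Independentᵇ-embed k (step G) s ind))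

extend-grow : ∀ k G T → Independentᵇ (E G) T →
  Σ (Fin (V (grow k G)) → Bool) λ s → Independentᵇ (E (grow k G)) s × (∀ x → s (embed k G x) ≡ T x)
    × count s ≡ count T + weight k T (E G)
extend-grow zero G T ind = T , ind , (λ _ → refl) , sym (trans (cong (count T +_) (weight-zero T (E G))) (+-identityʳ _))
extend-grow (suc k) G T ind with Step.extend-step G k T ind
... | t , indt , t-old , sizet with extend-grow k (step G) t indt
... | s , inds , s-embed , sizes =
  s , inds , (λ x → trans (s-embed (Step.old G x)) (t-old x)) , trans sizes sizet

∣∷∩inside∷∣ : ∀ {N} a (S H : Subset N) → ∣ (a Vec.∷ S) ∩ (inside Vec.∷ H) ∣ ≡ 𝟙 a + ∣ S ∩ H ∣
∣∷∩inside∷∣ true  S H = refl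
∣∷∩inside∷∣ false S H = refl

∣∩outside∣≡0 : ∀ {N} (S : Subset N) → ∣ S ∩ Vec.tabulate (λ _ → outside) ∣ ≡ 0
∣∩outside∣≡0 Vec.[]           = refl
∣∩outside∣≡0 (true Vec.∷ S)  = ∣∩outside∣≡0 S
∣∩outside∣≡0 (false Vec.∷ S) = ∣∩outside∣≡0 S

hubCount≡count : ∀ G (S : Subset (V G)) (y : Fin 3 → Fin (V G)) → (∀ j → toℕ (y j) ≡ toℕ j) →
                 hubCount G S ≡ count (Vec.lookup S ∘ y)
hubCount≡count G = go
  where
  go : ∀ {N} (S : Subset N) (y : Fin 3 → Fin N) → (∀ j → toℕ (y j) ≡ toℕ j) →
       ∣ S ∩ Vec.tabulate (λ x → if toℕ x <ᵇ 3 then inside else outside) ∣ ≡ count (Vec.lookup S ∘ y)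
  go Vec.[] y _ with () ← y 0F
  go (a Vec.∷ Vec.[]) y y≡ with y 1F | y≡ 1F
  ... | 0F | ()
  go (a Vec.∷ b Vec.∷ Vec.[]) y y≡ with y 2F | y≡ 2F
  ... | 0F | ()
  ... | 1F | ()
  go (a Vec.∷ b Vec.∷ c Vec.∷ S) y y≡
    rewrite toℕ-injective {i = y 0F} {j = 0F} (y≡ 0F)
          | toℕ-injective {i = y 1F} {j = 1F} (y≡ 1F)
          | toℕ-injective {i = y 2F} {j = 2F} (y≡ 2F)
          | ∣∷∩inside∷∣ a (b Vec.∷ c Vec.∷ S) (inside Vec.∷ inside Vec.∷ Vec.tabulate (λ _ → outside))
          | ∣∷∩inside∷∣ b (c Vec.∷ S) (inside Vec.∷ Vec.tabulate (λ _ → outside))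
          | ∣∷∩inside∷∣ c S (Vec.tabulate (λ _ → outside))
          | ∣∩outside∣≡0 S
    = refl

-- α⁰ k and α¹ k are the paper's α⁰ and α¹ of 𝒢 (suc k), the triangle grown k times.
α⁰ α¹ : ℕ → ℕ
α⁰ k = 3 * inner₀ k
α¹ k = suc (inner₀ k + 2 * inner₁ k)

triangle-value₀ : ∀ k (T : Fin 3 → Bool) → count T ≡ 0 → count T + weight k T (E triangle) ≡ α⁰ k
triangle-value₀ k T = go (T 0F) (T 1F) (T 2F)
  where
  go : ∀ a b c → 𝟙 a + (𝟙 b + (𝟙 c + 0)) ≡ 0 →
       𝟙 a + (𝟙 b + (𝟙 c + 0)) + (inner k a b + (inner k b c + (inner k a c + 0))) ≡ α⁰ k
  go false false false _ = refl

triangle-value₁ : ∀ k (T : Fin 3 → Bool) → count T ≡ 1 → count T + weight k T (E triangle) ≡ α¹ k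
triangle-value₁ k T = go (T 0F) (T 1F) (T 2F)
  where
  go : ∀ a b c → 𝟙 a + (𝟙 b + (𝟙 c + 0)) ≡ 1 →
       𝟙 a + (𝟙 b + (𝟙 c + 0)) + (inner k a b + (inner k b c + (inner k a c + 0))) ≡ α¹ k
  go true  false false _ = cong suc (arith₁ (inner₀ k) (inner₁ k))
    where arith₁ : ∀ x y → y + (x + (y + 0)) ≡ x + 2 * y
          arith₁ = solve-∀
  go false true  false _ = cong suc (arith₂ (inner₀ k) (inner₁ k))
    where arith₂ : ∀ x y → y + (y + (x + 0)) ≡ x + 2 * y
          arith₂ = solve-∀
  go false false true  _ = refl

isMaxIndep-grow-triangle : ∀ k h m → (∀ T → count T ≡ h → count T + weight k T (E triangle) ≡ m) →
  (T : Fin 3 → Bool) → Independentᵇ (E triangle) T → count T ≡ h → IsMaxIndep (grow k triangle) h m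
isMaxIndep-grow-triangle k h m value T indT countT with extend-grow k triangle T indT
... | s , inds , s-embed , sizes = (S , indS , hubsS , sizeS) , bound
  where
  G = grow k triangle
  hubCount≡ : ∀ S → hubCount G S ≡ count (Vec.lookup S ∘ embed k triangle)
  hubCount≡ S = hubCount≡count G S (embed k triangle) (toℕ-embed k triangle)
  bound : ∀ S → Independent G S → hubCount G S ≡ h → ∣ S ∣ ≤ m
  bound S ind hubs = begin
    ∣ S ∣                                  ≡⟨ ∣S∣≡count S ⟩
    count (Vec.lookup S)                   ≤⟨ count-grow-≤ k triangle (Vec.lookup S) indᵇ ⟩
    count T′ + weight k T′ (E triangle)    ≡⟨ value T′ (trans (sym (hubCount≡ S)) hubs) ⟩
    m                                      ∎
    where
    open ≤-Reasoning
    indᵇ = Independent⇒Independentᵇ G S ind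
    T′ = Vec.lookup S ∘ embed k triangle
  S = Vec.tabulate s
  S≗s : ∀ x → Vec.lookup S x ≡ s x
  S≗s = lookup∘tabulate s
  indS : Independent G S
  indS = Independentᵇ⇒Independent G S (Independentᵇ-cong (E G) (sym ∘ S≗s) inds)
  hubsS : hubCount G S ≡ h
  hubsS = trans (hubCount≡ S) (trans (count-cong (λ x → trans (S≗s _) (s-embed x))) countT)
  sizeS : ∣ S ∣ ≡ m
  sizeS = trans (∣S∣≡count S) (trans (count-cong S≗s) (trans sizes (value T countT)))

IsMaxIndep-unique : ∀ {G h m m′} → IsMaxIndep G h m → IsMaxIndep G h m′ → m ≡ m′
IsMaxIndep-unique ((S , indS , hubsS , refl) , boundS) ((S′ , indS′ , hubsS′ , refl) , boundS′) =
  ≤-antisym (boundS′ S indS hubsS) (boundS S′ indS′ hubsS′)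

𝒢-isMaxIndep⁰ : ∀ k → IsMaxIndep (𝒢 (suc k)) 0 (α⁰ k)
𝒢-isMaxIndep⁰ k = subst (λ G → IsMaxIndep G 0 (α⁰ k)) (sym (𝒢≡grow k))
  (isMaxIndep-grow-triangle k 0 (α⁰ k) (triangle-value₀ k) (λ _ → false) (refl ∷ refl ∷ refl ∷ []) refl)

𝒢-isMaxIndep¹ : ∀ k → IsMaxIndep (𝒢 (suc k)) 1 (α¹ k)
𝒢-isMaxIndep¹ k = subst (λ G → IsMaxIndep G 1 (α¹ k)) (sym (𝒢≡grow k))
  (isMaxIndep-grow-triangle k 1 (α¹ k) (triangle-value₁ k) onlyFirst (refl ∷ refl ∷ refl ∷ []) refl)
  where
  onlyFirst : Fin 3 → Bool
  onlyFirst fzero    = true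
  onlyFirst (fsuc _) = false

3[p⊔q]≡3p⊔[2p+q]⊔[p+2q]⊔3q : ∀ p q → 3 * (p ⊔ q) ≡ (3 * p) ⊔ (2 * p + q) ⊔ (p + 2 * q) ⊔ (3 * q)
3[p⊔q]≡3p⊔[2p+q]⊔[p+2q]⊔3q p q = ≤-antisym
  (≤-trans (≤-reflexive (*-distribˡ-⊔ 3 p q))
           (⊔-lub (≤-trans (m≤m⊔n (3 * p) (2 * p + q))
                    (≤-trans (m≤m⊔n _ (p + 2 * q)) (m≤m⊔n _ (3 * q))))
                  (m≤n⊔m (3 * p ⊔ (2 * p + q) ⊔ (p + 2 * q)) (3 * q))))
  (⊔-lub (⊔-lub (⊔-lub (*-monoʳ-≤ 3 p≤M) twoP+q≤3M) p+twoQ≤3M) (*-monoʳ-≤ 3 q≤M))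
  where
  M = p ⊔ q
  p≤M = m≤m⊔n p q
  q≤M = m≤n⊔m p q
  twoP+q≤3M : 2 * p + q ≤ 3 * M
  twoP+q≤3M = ≤-trans (+-mono-≤ (*-monoʳ-≤ 2 p≤M) q≤M) (≤-reflexive (arith M))
    where arith : ∀ x → 2 * x + x ≡ 3 * x
          arith = solve-∀
  p+twoQ≤3M : p + 2 * q ≤ 3 * M
  p+twoQ≤3M = +-mono-≤ p≤M (*-monoʳ-≤ 2 q≤M)

p⊔q+[2q∸1]≡[2q+p∸1]⊔[3q∸1] : ∀ p {q} → 1 ≤ q → (p ⊔ q) + (2 * q ∸ 1) ≡ (2 * q + p ∸ 1) ⊔ (3 * q ∸ 1)
p⊔q+[2q∸1]≡[2q+p∸1]⊔[3q∸1] p {suc r} _ =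
  trans (+-distribʳ-⊔ (2 * suc r ∸ 1) p (suc r)) (cong₂ _⊔_ (+-comm p (2 * suc r ∸ 1)) (arith r))
  -- both sides are stated in the form to which the truncated subtractions reduce for q = suc r
  where arith : ∀ r → suc r + (r + suc (r + 0)) ≡ r + (suc r + (suc r + 0))
        arith = solve-∀

α¹-suc : ∀ k → α¹ (suc k) ≡ (α⁰ k ⊔ α¹ k) + (2 * α¹ k ∸ 1)
α¹-suc k = trans (sym (+-suc (α⁰ k ⊔ α¹ k) _)) (cong (α⁰ k ⊔ α¹ k +_) (arith (inner₀ k) (inner₁ k)))
  where arith : ∀ x y → suc (2 * (2 * y + x)) ≡ (x + 2 * y) + suc ((x + 2 * y) + 0)
        arith = solve-∀

α-recurrence : ∀ k {a0 a1 b0 b1} → α⁰ k ≡ a0 → α¹ k ≡ a1 → α⁰ (suc k) ≡ b0 → α¹ (suc k) ≡ b1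
  → (b0 ≡ (3 * a0) ⊔ (2 * a0 + a1) ⊔ (a0 + 2 * a1) ⊔ (3 * a1))
  × (b1 ≡ (2 * a1 + a0 ∸ 1) ⊔ (3 * a1 ∸ 1))
α-recurrence k refl refl refl refl =
  3[p⊔q]≡3p⊔[2p+q]⊔[p+2q]⊔3q (α⁰ k) (α¹ k) ,
  trans (α¹-suc k) (p⊔q+[2q∸1]≡[2q+p∸1]⊔[3q∸1] (α⁰ k) (s≤s z≤n))

mainTheorem3 : (n : ℕ) → 1 ≤ n → (a0 a1 b0 b1 : ℕ)
    → IsMaxIndep (𝒢 n) 0 a0 → IsMaxIndep (𝒢 n) 1 a1
    → IsMaxIndep (𝒢 (suc n)) 0 b0 → IsMaxIndep (𝒢 (suc n)) 1 b1
    → (b0 ≡ (3 * a0) ⊔ (2 * a0 + a1) ⊔ (a0 + 2 * a1) ⊔ (3 * a1))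
    × (b1 ≡ (2 * a1 + a0 ∸ 1) ⊔ (3 * a1 ∸ 1))
mainTheorem3 (suc k) _ a0 a1 b0 b1 isMax⁰ isMax¹ isMax⁰′ isMax¹′ =
  α-recurrence k (IsMaxIndep-unique (𝒢-isMaxIndep⁰ k) isMax⁰)
                 (IsMaxIndep-unique (𝒢-isMaxIndep¹ k) isMax¹)
                 (IsMaxIndep-unique (𝒢-isMaxIndep⁰ (suc k)) isMax⁰′)
                 (IsMaxIndep-unique (𝒢-isMaxIndep¹ (suc k)) isMax¹′)
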